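{- The prefixes function $\Sigma^*\to\Sigma^{**}$, $[a_1,\ldots,a_n]\mapsto[[a_n,\ldots,a_1],[a_{n-1},\ldots,a_1],\ldots,[a_1]]$, is weakly derivable (for every list type $\Sigma$).
   Context: List types are generated by $1$, $\times$, $+$ (tagged disjoint union) and $*$; graded list types also allow $!$, which does not change underlying sets; the grade of a type is the maximal nesting of $!$. Strongly derivable functions are derived from the primes: commutativity and associativity of $\times$ and $+$; distributivity $\Gamma\times(\Sigma+\Delta)\leftrightarrow(\Gamma\times\Sigma)+(\Gamma\times\Delta)$; projections; co-projections; co-diagonal; append $\Sigma^*\times\Sigma\to\Sigma^*$; reverse; concat $\Sigma^{**}\to\Sigma^*$; create empty $\Sigma\to\Sigma\times\Gamma^*$; list distribute $(\Sigma\times\Gamma)^*\to\Sigma^*\times\Gamma^*$; $!(\Gamma+\Sigma)\leftrightarrow!\Gamma+!\Sigma$; $!(\Gamma\times\Sigma)\leftrightarrow!\Gamma\times!\Sigma$; $(!\Gamma)^*\leftrightarrow!(\Gamma^*)$; absorption $!\Gamma\to!\Gamma\times\Gamma$, $!x\mapsto(!x,x)$; with combinators composition, functoriality of $\times,+,*,!$, and safe fold: from $g:!^k1\to\Gamma$ and $\delta:\Gamma\times\Sigma\to\Gamma$ obtain $!^k(\Sigma^*)\to\Gamma$, $[a_1,\ldots,a_n]\mapsto b_n$ with $b_0$ the value of $g$ and $b_i=\delta(b_{i-1},a_i)$, allowed only if the grade of $\Gamma$ is $<k$. A function $f:\Sigma\to\Gamma$ is weakly derivable if some strongly derivable $!^k\Sigma\to\Gamma$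 equals $f$ on underlying sets. -}

module Defs where

open import Data.Nat using (ℕ; zero; suc; _⊔_; _<_)
open import Data.Unit using (⊤; tt)
open import Data.Product using (_×_; _,_; proj₁; proj₂; Σ-syntax)
open import Data.Sum using (_⊎_; inj₁; inj₂; [_,_])
open import Data.List using (List; []; _∷_; _++_; [_]; reverse; concat; map; foldl; unzip)
open import Relation.Binary.PropositionalEquality using (_≡_)

infixr 7 _⊗_
infixr 6 _⊕_

data Ty : Set where
  𝟙   : Ty
  _⊗_ : Ty → Ty → Ty
  _⊕_ : Ty → Ty → Ty
  _✶  : Ty → Ty
  !_  : Ty → Ty

data ListType : Ty → Set where
  𝟙-lt : ListType 𝟙
  ⊗-lt : ∀ {A B} → ListType A → ListType B → ListType (A ⊗ B)
  ⊕-lt : ∀ {A B} → ListType A → ListType B → ListType (A ⊕ B)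
  ✶-lt : ∀ {A} → ListType A → ListType (A ✶)

grade : Ty → ℕ
grade 𝟙       = 0
grade (A ⊗ B) = grade A ⊔ grade B
grade (A ⊕ B) = grade A ⊔ grade B
grade (A ✶)   = grade A
grade (! A)   = suc (grade A)

⟦_⟧ : Ty → Set
⟦ 𝟙 ⟧     = ⊤
⟦ A ⊗ B ⟧ = ⟦ A ⟧ × ⟦ B ⟧
⟦ A ⊕ B ⟧ = ⟦ A ⟧ ⊎ ⟦ B ⟧
⟦ A ✶ ⟧   = List ⟦ A ⟧
⟦ ! A ⟧   = ⟦ A ⟧

!^ : ℕ → Ty → Ty
!^ zero    A = A
!^ (suc k) A = ! (!^ k A)

unbang : ∀ k A → ⟦ !^ k A ⟧ → ⟦ A ⟧
unbang zero    A x = x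
unbang (suc k) A x = unbang k A x

bang : ∀ k A → ⟦ A ⟧ → ⟦ !^ k A ⟧
bang zero    A x = x
bang (suc k) A x = bang k A x

infix 4 _⇒_
data _⇒_ : Ty → Ty → Set where
  comm×    : ∀ {A B} → A ⊗ B ⇒ B ⊗ A
  assoc×   : ∀ {A B C} → (A ⊗ B) ⊗ C ⇒ A ⊗ (B ⊗ C)
  assoc×⁻¹ : ∀ {A B C} → A ⊗ (B ⊗ C) ⇒ (A ⊗ B) ⊗ C
  comm+    : ∀ {A B} → A ⊕ B ⇒ B ⊕ A
  assoc+   : ∀ {A B C} → (A ⊕ B) ⊕ C ⇒ A ⊕ (B ⊕ C)
  assoc+⁻¹ : ∀ {A B C} → A ⊕ (B ⊕ C) ⇒ (A ⊕ B) ⊕ C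
  distr    : ∀ {G S D} → G ⊗ (S ⊕ D) ⇒ (G ⊗ S) ⊕ (G ⊗ D)
  distr⁻¹  : ∀ {G S D} → (G ⊗ S) ⊕ (G ⊗ D) ⇒ G ⊗ (S ⊕ D)
  proj₁ᵖ   : ∀ {A B} → A ⊗ B ⇒ A
  proj₂ᵖ   : ∀ {A B} → A ⊗ B ⇒ B
  inj₁ᵖ    : ∀ {A B} → A ⇒ A ⊕ B
  inj₂ᵖ    : ∀ {A B} → B ⇒ A ⊕ B
  codiag   : ∀ {A} → A ⊕ A ⇒ A
  append   : ∀ {A} → A ✶ ⊗ A ⇒ A ✶
  rev      : ∀ {A} → A ✶ ⇒ A ✶
  concatᵖ  : ∀ {A} → A ✶ ✶ ⇒ A ✶
  empty    : ∀ {A B} → A ⇒ A ⊗ B ✶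
  ldistr   : ∀ {A B} → (A ⊗ B) ✶ ⇒ A ✶ ⊗ B ✶
  !⊕       : ∀ {A B} → ! (A ⊕ B) ⇒ ! A ⊕ ! B
  !⊕⁻¹     : ∀ {A B} → ! A ⊕ ! B ⇒ ! (A ⊕ B)
  !⊗       : ∀ {A B} → ! (A ⊗ B) ⇒ ! A ⊗ ! B
  !⊗⁻¹     : ∀ {A B} → ! A ⊗ ! B ⇒ ! (A ⊗ B)
  ✶!       : ∀ {A} → (! A) ✶ ⇒ ! (A ✶)
  ✶!⁻¹     : ∀ {A} → ! (A ✶) ⇒ (! A) ✶
  absorb   : ∀ {A} → ! A ⇒ ! A ⊗ A
  _∘ᵈ_     : ∀ {A B C} → B ⇒ C → A ⇒ B → A ⇒ C
  _⊗ᵈ_     : ∀ {A B C D} → A ⇒ C → B ⇒ D → A ⊗ B ⇒ C ⊗ D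
  _⊕ᵈ_     : ∀ {A B C D} → A ⇒ C → B ⇒ D → A ⊕ B ⇒ C ⊕ D
  mapᵈ     : ∀ {A B} → A ⇒ B → A ✶ ⇒ B ✶
  !ᵈ       : ∀ {A B} → A ⇒ B → ! A ⇒ ! B
  fold     : ∀ {G S} (k : ℕ) → grade G < k →
             !^ k 𝟙 ⇒ G → G ⊗ S ⇒ G → !^ k (S ✶) ⇒ G

eval : ∀ {A B} → A ⇒ B → ⟦ A ⟧ → ⟦ B ⟧
eval comm× (a , b) = b , a
eval assoc× ((a , b) , c) = a , (b , c)
eval assoc×⁻¹ (a , (b , c)) = (a , b) , c
eval comm+ (inj₁ a) = inj₂ a
eval comm+ (inj₂ b) = inj₁ b
eval assoc+ (inj₁ (inj₁ a)) = inj₁ a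
eval assoc+ (inj₁ (inj₂ b)) = inj₂ (inj₁ b)
eval assoc+ (inj₂ c) = inj₂ (inj₂ c)
eval assoc+⁻¹ (inj₁ a) = inj₁ (inj₁ a)
eval assoc+⁻¹ (inj₂ (inj₁ b)) = inj₁ (inj₂ b)
eval assoc+⁻¹ (inj₂ (inj₂ c)) = inj₂ c
eval distr (g , inj₁ s) = inj₁ (g , s)
eval distr (g , inj₂ d) = inj₂ (g , d)
eval distr⁻¹ (inj₁ (g , s)) = g , inj₁ s
eval distr⁻¹ (inj₂ (g , d)) = g , inj₂ d
eval proj₁ᵖ (a , b) = a
eval proj₂ᵖ (a , b) = b
eval inj₁ᵖ a = inj₁ a
eval inj₂ᵖ b = inj₂ b
eval codiag (inj₁ a) = a
eval codiag (inj₂ a) = a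
eval append (xs , x) = xs ++ [ x ]
eval rev xs = reverse xs
eval concatᵖ xss = concat xss
eval empty a = a , []
eval ldistr ps = unzip ps
eval !⊕ x = x
eval !⊕⁻¹ x = x
eval !⊗ x = x
eval !⊗⁻¹ x = x
eval ✶! x = x
eval ✶!⁻¹ x = x
eval absorb x = x , x
eval (f ∘ᵈ g) x = eval f (eval g x)
eval (f ⊗ᵈ g) (a , b) = eval f a , eval g b
eval (f ⊕ᵈ g) (inj₁ a) = inj₁ (eval f a)
eval (f ⊕ᵈ g) (inj₂ b) = inj₂ (eval g b)
eval (mapᵈ f) xs = map (eval f) xs
eval (!ᵈ f) x = eval f x
eval (fold {S = S} k _ g δ) xs =
  foldl (λ b a → eval δ (b , a)) (eval g (bang k 𝟙 tt)) (unbang k (S ✶) xs)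

WeaklyDerivable : ∀ {A B} → (⟦ A ⟧ → ⟦ B ⟧) → Set
WeaklyDerivable {A} {B} f =
  Σ[ k ∈ ℕ ] Σ[ d ∈ !^ k A ⇒ B ] (∀ x → eval d (bang k A x) ≡ f x)

nonemptyInits : ∀ {X : Set} → List X → List (List X)
nonemptyInits []       = []
nonemptyInits (x ∷ xs) = [ x ] ∷ map (x ∷_) (nonemptyInits xs)

prefixes : ∀ {X : Set} → List X → List (List X)
prefixes xs = reverse (map reverse (nonemptyInits xs))

{-# OPTIONS --safe #-}
-- Fold over the input keeping the pair (prefixes found so far, current prefix).
-- Each new letter is appended to the current prefix, which is then duplicated by
-- absorption: one copy is reversed and appended to the output, the other is kept.
-- For absorption to apply, the current prefix is stored as a list of !-elements,
-- so the accumulator has grade 1 and the safe fold needs !², plus one more ! to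
-- turn !(Σ*) into (!Σ)*; hence prefixes is weakly derivable with k = 3.
module Submission where

open import Defs
open import Data.Nat using (_<_; s≤s; z≤n)
open import Data.Product using (_×_; _,_; proj₁)
open import Data.List using (List; []; _∷_; _++_; [_]; reverse; map; foldl)
open import Data.List.Properties using (++-assoc; ++-identityʳ; map-∘; map-cong)
open import Relation.Binary.PropositionalEquality
  using (_≡_; refl; sym; cong; cong₂; module ≡-Reasoning)

listType-grade : ∀ {S} → ListType S → grade S ≡ 0
listType-grade 𝟙-lt = refl
listType-grade (⊗-lt a b) rewrite listType-grade a | listType-grade b = refl
listType-grade (⊕-lt a b) rewrite listType-grade a | listType-grade b = refl
listType-grade (✶-lt a) = listType-grade a

idᵈ : ∀ {A} → A ⇒ A
idᵈ = proj₁ᵖ ∘ᵈ empty {B = 𝟙}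

absorb✶ : ∀ {A} → (! A) ✶ ⇒ (! A) ✶ ⊗ A ✶
absorb✶ = (✶!⁻¹ ⊗ᵈ idᵈ) ∘ᵈ (absorb ∘ᵈ ✶!)

module _ {X : Set} where

  snocPrefix : List (List X) × List X → X → List (List X) × List X
  snocPrefix (out , cur) x = out ++ [ reverse (cur ++ [ x ]) ] , cur ++ [ x ]

  foldl-snocPrefix : ∀ xs out cur →
    foldl snocPrefix (out , cur) xs
      ≡ (out ++ map (λ p → reverse (cur ++ p)) (nonemptyInits xs) , cur ++ xs)
  foldl-snocPrefix [] out cur = cong₂ _,_ (sym (++-identityʳ out)) (sym (++-identityʳ cur))
  foldl-snocPrefix (x ∷ xs) out cur rewrite foldl-snocPrefix xs (out ++ [ reverse (cur ++ [ x ]) ]) (cur ++ [ x ]) =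
    cong₂ _,_ outputs (++-assoc cur [ x ] xs)
    where
    open ≡-Reasoning
    outputs : (out ++ [ reverse (cur ++ [ x ]) ])
                ++ map (λ p → reverse ((cur ++ [ x ]) ++ p)) (nonemptyInits xs)
            ≡ out ++ map (λ p → reverse (cur ++ p)) (nonemptyInits (x ∷ xs))
    outputs = begin
      (out ++ [ reverse (cur ++ [ x ]) ]) ++ map (λ p → reverse ((cur ++ [ x ]) ++ p)) (nonemptyInits xs)
        ≡⟨ ++-assoc out _ _ ⟩
      out ++ reverse (cur ++ [ x ]) ∷ map (λ p → reverse ((cur ++ [ x ]) ++ p)) (nonemptyInits xs)
        ≡⟨ cong (λ ps → out ++ reverse (cur ++ [ x ]) ∷ ps)
                (map-cong (λ p → cong reverse (++-assoc cur [ x ] p)) (nonemptyInits xs)) ⟩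
      out ++ reverse (cur ++ [ x ]) ∷ map (λ p → reverse (cur ++ x ∷ p)) (nonemptyInits xs)
        ≡⟨ cong (λ ps → out ++ reverse (cur ++ [ x ]) ∷ ps) (map-∘ (nonemptyInits xs)) ⟩
      out ++ map (λ p → reverse (cur ++ p)) (nonemptyInits (x ∷ xs))
        ∎

module PrefixesDerivation (S : Ty) where

  State : Ty
  State = S ✶ ✶ ⊗ (! S) ✶

  start : !^ 2 𝟙 ⇒ State
  start = empty ∘ᵈ (proj₂ᵖ ∘ᵈ empty)

  step : State ⊗ ! S ⇒ State
  step = ((append ∘ᵈ (idᵈ ⊗ᵈ rev)) ⊗ᵈ idᵈ)
       ∘ᵈ (assoc×⁻¹ ∘ᵈ ((idᵈ ⊗ᵈ (comm× ∘ᵈ (absorb✶ ∘ᵈ append))) ∘ᵈ assoc×))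

  grade-State : grade S ≡ 0 → grade State < 2
  grade-State g≡0 rewrite g≡0 = s≤s (s≤s z≤n)

  prefixesᵈ : grade S ≡ 0 → !^ 3 (S ✶) ⇒ S ✶ ✶
  prefixesᵈ g≡0 = rev ∘ᵈ (proj₁ᵖ ∘ᵈ (fold 2 (grade-State g≡0) start step ∘ᵈ !ᵈ (!ᵈ ✶!⁻¹)))

  eval-prefixesᵈ : (g≡0 : grade S ≡ 0) (xs : ⟦ S ✶ ⟧) → eval (prefixesᵈ g≡0) xs ≡ prefixes xs
  eval-prefixesᵈ _ xs = cong (λ acc → reverse (proj₁ acc)) (foldl-snocPrefix xs [] [])

claim2 : (S : Ty) → ListType S → WeaklyDerivable {S ✶} {S ✶ ✶} prefixes
claim2 S lt = 3 , prefixesᵈ (listType-grade lt) , eval-prefixesᵈ (listType-grade lt)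
  where open PrefixesDerivation S
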